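{- For the single-cache file-bundle caching problem with cache size $k$ and queries of length $l$, the farthest-in-future (FF) algorithm achieves an approximation factor of at most $2l$ compared to the optimal offline algorithm: there is a constant $c$ independent of $\sigma$ such that for every query sequence $\sigma$, $\mathrm{FF}(\sigma)\le 2l\cdot\mathrm{OPT}(\sigma)+c$.
   Context: File-bundle caching: pages $\mathcal{O}=\{1,\dots,N\}$; a single cache with content $C_t\subset\mathcal{O}$, $|C_t|=k$; at each time $t$ a query $Q_t\subset\mathcal{O}$ with $|Q_t|=l$ arrives; a cache miss (unit cost) occurs if $Q_t\not\subseteq C_t$, in which case the cache must insert the pages of $Q_t$ by evicting some pages; no other changes are allowed. $\mathrm{OPT}(\sigma)$ is the minimum number of cache misses achievable on $\sigma$ with full knowledge of the sequence. The farthest-in-future (FF) algorithm knows all future queries and, whenever evictions are needed, evicts the cache pages whose next request lies farthest in the future. -}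

module Defs where

open import Data.Nat using (ℕ; zero; suc; _≤_)
open import Data.Bool using (true; false)
open import Data.Fin using (Fin)
open import Data.Fin.Subset using (Subset; _∈_; _∉_; _⊆_; _∪_; ∣_∣)
open import Data.List using (List; []; _∷_)
open import Data.Product using (_×_)
open import Data.Vec using (lookup)
open import Relation.Binary.PropositionalEquality using (_≡_)
open import Relation.Nullary using (¬_)

-- Pages are Fin N; caches and queries are subsets of the pages.
-- A query sequence σ is a list of queries (time runs left to right).

-- Index (0-based) of the next request of page p in the future sequence qs;
-- if p is never requested again, the value is  length qs, which exceeds
-- every actual request index (so "never again" counts as farthest).
next : ∀ {N} → Fin N → List (Subset N) → ℕ
next p [] = zero
next p (Q ∷ qs) with lookup Q p
... | true  = zero
... | false = suc (next p qs)

record MissStep {N} (k : ℕ) (C Q C' : Subset N) : Set where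
  field
    covers : Q ⊆ C'
    onlyQ  : C' ⊆ C ∪ Q
    size   : ∣ C' ∣ ≡ k

data Run {N} (k : ℕ) : Subset N → List (Subset N) → ℕ → Set where
  done : ∀ {C} → Run k C [] zero
  hit  : ∀ {C Q qs m} → Q ⊆ C → Run k C qs m → Run k C (Q ∷ qs) m
  miss : ∀ {C Q C' qs m} → ¬ (Q ⊆ C) → MissStep k C Q C' →
         Run k C' qs m → Run k C (Q ∷ qs) (suc m)

FFRule : ∀ {N} → Subset N → Subset N → Subset N → List (Subset N) → Set
FFRule {N} C Q C' qs =
  ∀ (p p' : Fin N) → p ∈ C → p ∉ C' → p' ∈ C → p' ∈ C' → p' ∉ Q →
  next p' qs ≤ next p qs

-- FFRun k C σ m : some execution of FF (with arbitrary tie-breaking) from cache C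
-- on σ incurs exactly m cache misses.
data FFRun {N} (k : ℕ) : Subset N → List (Subset N) → ℕ → Set where
  done : ∀ {C} → FFRun k C [] zero
  hit  : ∀ {C Q qs m} → Q ⊆ C → FFRun k C qs m → FFRun k C (Q ∷ qs) m
  miss : ∀ {C Q C' qs m} → ¬ (Q ⊆ C) → MissStep k C Q C' →
         FFRule C Q C' qs →
         FFRun k C' qs m → FFRun k C (Q ∷ qs) (suc m)

IsOPT : ∀ {N} (k : ℕ) → Subset N → List (Subset N) → ℕ → Set
IsOPT {N} k C σ m = Run k C σ m × (∀ m' → Run k C σ m' → m ≤ m')

-- Run FF (cache F) and an optimal schedule (cache O) side by side, and call a page soon for
-- horizon τ if it is requested within the next τ + 1 queries. The invariant (Budget) is that
-- for every τ the soon pages of O ∖ F outnumber the soon pages of F ∖ O by at most P, while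
-- FF ≤ 2l·OPT + P. After serving a query, horizon τ + 1 becomes horizon τ. If FF evicted a
-- page that is soon, the farthest-in-future rule makes all of F ∖ O soon, and
-- |O ∖ F| = |F ∖ O| gives the inequality outright. Otherwise both differences only shift,
-- except that OPT's change of O can add up to |Q ∖ O| ≤ l pages to F ∖ O: an OPT miss raises
-- P by l, which together with a possible FF miss is paid by the 2l it adds to the bound. An
-- FF miss on which OPT hits exposes a page of Q in O ∖ F that is soon for horizon 0, which
-- forces P ≥ 1 and lets the miss be paid by lowering P.

module Submission where

open import Defs
open import Data.Nat using (ℕ; _≤_; _+_; _*_)
open import Data.Fin.Subset using (Subset; ∣_∣)
open import Data.List using (List)
open import Data.List.Relation.Unary.All using (All)
open import Data.Product using (∃)
open import Relation.Binary.PropositionalEquality using (_≡_)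

open import Data.Nat using (zero; suc; _<_; _≤ᵇ_; z≤n; s≤s; s≤s⁻¹)
open import Data.Nat.Properties
open import Data.Nat.Tactic.RingSolver using (solve-∀)
open import Data.Bool using (true; false)
open import Data.Bool.Properties using (T-≡)
open import Data.Fin using (Fin; zero)
open import Data.Fin.Subset using (_∈_; _∉_; _⊆_; _∩_; _∪_; _─_; ⊥; Empty; Nonempty)
open import Data.Fin.Subset.Properties
open import Data.Vec using (_∷_; []; here; there; lookup; tabulate)
open import Data.Vec.Properties using ([]=⇒lookup; lookup⇒[]=; lookup∘tabulate)
open import Data.List using ([]; _∷_)
open import Data.List.Relation.Unary.All using ([]; _∷_)
open import Data.Product using (_,_; _×_)
open import Data.Sum using (inj₁; inj₂)
open import Function using (_∘_)
open import Function.Bundles using (Equivalence)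
open import Relation.Binary.PropositionalEquality
  using (refl; sym; trans; cong; subst; module ≡-Reasoning)
open import Relation.Nullary using (¬_; yes; no; contradiction)
open import Relation.Nullary.Decidable using (decidable-stable)

private variable
  n k l ff opt P P' τ : ℕ
  x : Fin n
  p q r F F' O O' Q : Subset n
  qs σ : List (Subset n)

x∈p─q⁻ : ∀ (p q : Subset n) → x ∈ p ─ q → x ∈ p × x ∉ q
x∈p─q⁻ {x = zero} (true  ∷ p) (false ∷ q) here = here , λ ()
x∈p─q⁻ {x = zero} (false ∷ p) (false ∷ q) ()
x∈p─q⁻ {x = zero} (_     ∷ p) (true  ∷ q) ()
x∈p─q⁻ (_ ∷ p) (_ ∷ q) (there x∈p─q) with x∈p─q⁻ p q x∈p─q
... | x∈p , x∉q = there x∈p , x∉q ∘ drop-there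

x∈p∪q∧x∉q⇒x∈p : x ∈ p ∪ q → x ∉ q → x ∈ p
x∈p∪q∧x∉q⇒x∈p {p = p} {q} x∈p∪q x∉q with x∈p∪q⁻ p q x∈p∪q
... | inj₁ x∈p = x∈p
... | inj₂ x∈q = contradiction x∈q x∉q

Empty[p─q∩r]⇒p∩r⊆q : Empty ((p ─ q) ∩ r) → p ∩ r ⊆ q
Empty[p─q∩r]⇒p∩r⊆q {p = p} {q} {r} empty {x} x∈p∩r with x∈p∩q⁻ p r x∈p∩r
... | x∈p , x∈r = decidable-stable (x ∈? q)
  λ x∉q → empty (x , x∈p∩q⁺ (x∈p∧x∉q⇒x∈p─q x∈p x∉q , x∈r))

p⊈q⇒∃x∈p∧x∉q : ¬ (p ⊆ q) → ∃ λ x → x ∈ p × x ∉ q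
p⊈q⇒∃x∈p∧x∉q {p = p} {q} p⊈q with nonempty? (p ─ q)
... | yes (x , x∈p─q) = x , x∈p─q⁻ p q x∈p─q
... | no empty = contradiction (λ {x} x∈p → decidable-stable (x ∈? q)
  λ x∉q → empty (x , x∈p∧x∉q⇒x∈p─q x∈p x∉q)) p⊈q

x∈p⇒0<∣p∣ : x ∈ p → 0 < ∣ p ∣
x∈p⇒0<∣p∣ x∈p = ≤-trans (s≤s z≤n) (x∈p⇒∣p-x∣<∣p∣ x∈p)

p⊆q⇒∣p─q∣≡0 : ∀ {n} {p q : Subset n} → p ⊆ q → ∣ p ─ q ∣ ≡ 0
p⊆q⇒∣p─q∣≡0 {n} {p} {q} p⊆q =
  n≤0⇒n≡0 (≤-trans (p⊆q⇒∣p∣≤∣q∣ p─q⊆⊥) (≤-reflexive (∣⊥∣≡0 n)))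
  where
  p─q⊆⊥ : p ─ q ⊆ ⊥
  p─q⊆⊥ x∈p─q with x∈p─q⁻ p q x∈p─q
  ... | x∈p , x∉q = contradiction (p⊆q x∈p) x∉q

∣p∪q∣≤∣p∣+∣q∣ : ∀ (p q : Subset n) → ∣ p ∪ q ∣ ≤ ∣ p ∣ + ∣ q ∣
∣p∪q∣≤∣p∣+∣q∣ []          []          = z≤n
∣p∪q∣≤∣p∣+∣q∣ (true  ∷ p) (true  ∷ q) =
  s≤s (≤-trans (∣p∪q∣≤∣p∣+∣q∣ p q) (+-monoʳ-≤ ∣ p ∣ (n≤1+n ∣ q ∣)))
∣p∪q∣≤∣p∣+∣q∣ (true  ∷ p) (false ∷ q) = s≤s (∣p∪q∣≤∣p∣+∣q∣ p q)
∣p∪q∣≤∣p∣+∣q∣ (false ∷ p) (true  ∷ q) =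
  ≤-trans (s≤s (∣p∪q∣≤∣p∣+∣q∣ p q)) (≤-reflexive (sym (+-suc ∣ p ∣ ∣ q ∣)))
∣p∪q∣≤∣p∣+∣q∣ (false ∷ p) (false ∷ q) = ∣p∪q∣≤∣p∣+∣q∣ p q

∣p∣≡∣p∩q∣+∣p─q∣ : ∀ (p q : Subset n) → ∣ p ∣ ≡ ∣ p ∩ q ∣ + ∣ p ─ q ∣
∣p∣≡∣p∩q∣+∣p─q∣ []          []          = refl
∣p∣≡∣p∩q∣+∣p─q∣ (true  ∷ p) (true  ∷ q) = cong suc (∣p∣≡∣p∩q∣+∣p─q∣ p q)
∣p∣≡∣p∩q∣+∣p─q∣ (true  ∷ p) (false ∷ q) =
  trans (cong suc (∣p∣≡∣p∩q∣+∣p─q∣ p q)) (sym (+-suc ∣ p ∩ q ∣ ∣ p ─ q ∣))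
∣p∣≡∣p∩q∣+∣p─q∣ (false ∷ p) (true  ∷ q) = ∣p∣≡∣p∩q∣+∣p─q∣ p q
∣p∣≡∣p∩q∣+∣p─q∣ (false ∷ p) (false ∷ q) = ∣p∣≡∣p∩q∣+∣p─q∣ p q

∣p∣≡∣q∣⇒∣p─q∣≡∣q─p∣ : ∀ (p q : Subset n) → ∣ p ∣ ≡ ∣ q ∣ → ∣ p ─ q ∣ ≡ ∣ q ─ p ∣
∣p∣≡∣q∣⇒∣p─q∣≡∣q─p∣ p q ∣p∣≡∣q∣ = +-cancelˡ-≡ ∣ p ∩ q ∣ _ _ (begin
  ∣ p ∩ q ∣ + ∣ p ─ q ∣  ≡⟨ sym (∣p∣≡∣p∩q∣+∣p─q∣ p q) ⟩
  ∣ p ∣                  ≡⟨ ∣p∣≡∣q∣ ⟩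
  ∣ q ∣                  ≡⟨ ∣p∣≡∣p∩q∣+∣p─q∣ q p ⟩
  ∣ q ∩ p ∣ + ∣ q ─ p ∣  ≡⟨ cong (λ s → ∣ s ∣ + ∣ q ─ p ∣) (∩-comm q p) ⟩
  ∣ p ∩ q ∣ + ∣ q ─ p ∣  ∎)
  where open ≡-Reasoning

next-∈ : x ∈ Q → next x (Q ∷ qs) ≡ 0
next-∈ {x = x} {Q = Q} x∈Q rewrite []=⇒lookup x∈Q = refl

next-∉ : x ∉ Q → next x (Q ∷ qs) ≡ suc (next x qs)
next-∉ {x = x} {Q = Q} x∉Q with lookup Q x in eq
... | true  = contradiction (lookup⇒[]= x Q eq) x∉Q
... | false = refl

next-∷-≤ : ∀ (x : Fin n) Q qs → next x (Q ∷ qs) ≤ suc (next x qs)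
next-∷-≤ x Q qs with lookup Q x
... | true  = z≤n
... | false = ≤-refl

-- Pages whose next request has index at most τ, i.e. lies among the first τ + 1 queries.
-- Opaque so that qs and τ remain inferable from membership proofs.
opaque
  soon : List (Subset n) → ℕ → Subset n
  soon qs τ = tabulate λ x → next x qs ≤ᵇ τ

  x∈soon⁺ : next x qs ≤ τ → x ∈ soon qs τ
  x∈soon⁺ {x = x} h =
    lookup⇒[]= x _ (trans (lookup∘tabulate _ x) (Equivalence.to T-≡ (≤⇒≤ᵇ h)))

  x∈soon⁻ : x ∈ soon qs τ → next x qs ≤ τ
  x∈soon⁻ {x = x} x∈ =
    ≤ᵇ⇒≤ _ _ (Equivalence.from T-≡ (trans (sym (lookup∘tabulate _ x)) ([]=⇒lookup x∈)))

x∈Q⇒x∈soon : x ∈ Q → x ∈ soon (Q ∷ qs) τ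
x∈Q⇒x∈soon {qs = qs} {τ = τ} x∈Q = x∈soon⁺ (subst (_≤ τ) (sym (next-∈ {qs = qs} x∈Q)) z≤n)

soon-∷⁺ : x ∈ soon qs τ → x ∈ soon (Q ∷ qs) (suc τ)
soon-∷⁺ {x = x} {qs = qs} {Q = Q} x∈ = x∈soon⁺ (≤-trans (next-∷-≤ x Q qs) (s≤s (x∈soon⁻ x∈)))

soon-∷⁻ : x ∉ Q → x ∈ soon (Q ∷ qs) (suc τ) → x ∈ soon qs τ
soon-∷⁻ {qs = qs} x∉Q x∈ = x∈soon⁺ (s≤s⁻¹ (subst (_≤ _) (next-∉ {qs = qs} x∉Q) (x∈soon⁻ x∈)))

soon-∷-zero⊆ : soon (Q ∷ qs) zero ⊆ Q
soon-∷-zero⊆ {Q = Q} {qs = qs} {x} x∈ = decidable-stable (x ∈? Q) λ x∉Q →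
  contradiction (subst (_≤ 0) (next-∉ {qs = qs} x∉Q) (x∈soon⁻ x∈)) λ ()

record Budget (F O : Subset n) (qs : List (Subset n)) (P : ℕ) : Set where
  field
    bound : ∀ τ → ∣ (O ─ F) ∩ soon qs τ ∣ ≤ ∣ (F ─ O) ∩ soon qs τ ∣ + P

open Budget

Budget-mono : P ≤ P' → Budget F O qs P → Budget F O qs P'
Budget-mono P≤P' budget .bound τ = ≤-trans (budget .bound τ) (+-monoʳ-≤ _ P≤P')

Budget-mono-request : ∣ Q ∣ ≡ l → Budget F O qs (∣ Q ─ O' ∣ + P) → Budget F O qs (l + P)
Budget-mono-request {Q = Q} {O' = O'} {P = P} ∣Q∣≡l =
  Budget-mono (+-monoˡ-≤ P (≤-trans (∣p─q∣≤∣p∣ Q O') (≤-reflexive ∣Q∣≡l)))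

soon-eviction⇒balanced : Q ⊆ O → F' ⊆ F ∪ Q → FFRule F Q F' qs → ∣ F' ∣ ≡ ∣ O ∣ →
  Nonempty ((F ─ F') ∩ soon qs τ) →
  ∣ (O ─ F') ∩ soon qs τ ∣ ≤ ∣ (F' ─ O) ∩ soon qs τ ∣
soon-eviction⇒balanced {Q = Q} {O = O} {F' = F'} {F = F} {qs = qs} {τ = τ}
  Q⊆O F'⊆F∪Q rule ∣F'∣≡∣O∣ (e , e∈)
  with x∈p∩q⁻ (F ─ F') (soon qs τ) e∈
... | e∈F─F' , e-soon with x∈p─q⁻ F F' e∈F─F'
... | e∈F , e∉F' = begin
  ∣ (O ─ F') ∩ soon qs τ ∣  ≤⟨ ∣p∩q∣≤∣p∣ (O ─ F') (soon qs τ) ⟩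
  ∣ O ─ F' ∣                ≡⟨ ∣p∣≡∣q∣⇒∣p─q∣≡∣q─p∣ O F' (sym ∣F'∣≡∣O∣) ⟩
  ∣ F' ─ O ∣                ≤⟨ p⊆q⇒∣p∣≤∣q∣ F'─O⊆soon ⟩
  ∣ (F' ─ O) ∩ soon qs τ ∣  ∎
  where
  open ≤-Reasoning
  F'─O⊆soon : F' ─ O ⊆ (F' ─ O) ∩ soon qs τ
  F'─O⊆soon {x} x∈F'─O with x∈p─q⁻ F' O x∈F'─O
  ... | x∈F' , x∉O = x∈p∩q⁺ (x∈F'─O , x∈soon⁺ (≤-trans next-x≤next-e (x∈soon⁻ e-soon)))
    where
    x∉Q : x ∉ Q
    x∉Q = x∉O ∘ Q⊆O
    next-x≤next-e : next x qs ≤ next e qs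
    next-x≤next-e = rule e x e∈F e∉F' (x∈p∪q∧x∉q⇒x∈p (F'⊆F∪Q x∈F') x∉Q) x∈F' x∉Q

missing-soon-step : Q ⊆ F' → O' ⊆ O ∪ Q → Empty ((F ─ F') ∩ soon qs τ) →
  (O' ─ F') ∩ soon qs τ ⊆ (O ─ F) ∩ soon (Q ∷ qs) (suc τ) ─ Q
missing-soon-step {Q = Q} {F' = F'} {O' = O'} {O = O} {F = F} {qs = qs} {τ = τ}
  Q⊆F' O'⊆O∪Q late {x} x∈
  with x∈p∩q⁻ (O' ─ F') (soon qs τ) x∈
... | x∈O'─F' , x-soon with x∈p─q⁻ O' F' x∈O'─F'
... | x∈O' , x∉F' = x∈p∧x∉q⇒x∈p─q (x∈p∩q⁺ (x∈p∧x∉q⇒x∈p─q x∈O x∉F , soon-∷⁺ x-soon)) x∉Q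
  where
  x∉Q : x ∉ Q
  x∉Q = x∉F' ∘ Q⊆F'
  x∈O : x ∈ O
  x∈O = x∈p∪q∧x∉q⇒x∈p (O'⊆O∪Q x∈O') x∉Q
  x∉F : x ∉ F
  x∉F x∈F = x∉F' (Empty[p─q∩r]⇒p∩r⊆q late (x∈p∩q⁺ (x∈F , x-soon)))

surplus-soon-step : O' ⊆ O ∪ Q → Empty ((F ─ F') ∩ soon qs τ) →
  (F ─ O) ∩ soon (Q ∷ qs) (suc τ) ⊆ (F' ─ O') ∩ soon qs τ ∪ (Q ─ O)
surplus-soon-step {O' = O'} {O = O} {Q = Q} {F = F} {F' = F'} {qs = qs} {τ = τ}
  O'⊆O∪Q late {x} x∈
  with x∈p∩q⁻ (F ─ O) (soon (Q ∷ qs) (suc τ)) x∈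
... | x∈F─O , x-soon with x∈p─q⁻ F O x∈F─O | x ∈? Q
... | x∈F , x∉O | yes x∈Q = x∈p∪q⁺ (inj₂ (x∈p∧x∉q⇒x∈p─q x∈Q x∉O))
... | x∈F , x∉O | no x∉Q = x∈p∪q⁺ (inj₁ (x∈p∩q⁺ (x∈p∧x∉q⇒x∈p─q x∈F' x∉O' , x-soon')))
  where
  x-soon' : x ∈ soon qs τ
  x-soon' = soon-∷⁻ x∉Q x-soon
  x∈F' : x ∈ F'
  x∈F' = Empty[p─q∩r]⇒p∩r⊆q late (x∈p∩q⁺ (x∈F , x-soon'))
  x∉O' : x ∉ O'
  x∉O' x∈O' = x∉O (x∈p∪q∧x∉q⇒x∈p (O'⊆O∪Q x∈O') x∉Q)

requested-missing-soon : Q ⊆ O → x ∈ Q → x ∉ F → x ∈ (O ─ F) ∩ soon (Q ∷ qs) τ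
requested-missing-soon Q⊆O x∈Q x∉F =
  x∈p∩q⁺ (x∈p∧x∉q⇒x∈p─q (Q⊆O x∈Q) x∉F , x∈Q⇒x∈soon x∈Q)

budget-shift : O' ⊆ O ∪ Q → Empty ((F ─ F') ∩ soon qs τ) → Budget F O (Q ∷ qs) P →
  ∣ (O ─ F) ∩ soon (Q ∷ qs) (suc τ) ∣ ≤ ∣ (F' ─ O') ∩ soon qs τ ∣ + (∣ Q ─ O ∣ + P)
budget-shift {O' = O'} {O = O} {Q = Q} {F = F} {F' = F'} {qs = qs} {τ = τ} {P = P}
  O'⊆O∪Q late budget = begin
  ∣ (O ─ F) ∩ soon (Q ∷ qs) (suc τ) ∣         ≤⟨ budget .bound (suc τ) ⟩
  ∣ (F ─ O) ∩ soon (Q ∷ qs) (suc τ) ∣ + P     ≤⟨ +-monoˡ-≤ P (p⊆q⇒∣p∣≤∣q∣ (surplus-soon-step O'⊆O∪Q late)) ⟩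
  ∣ (F' ─ O') ∩ soon qs τ ∪ (Q ─ O) ∣ + P     ≤⟨ +-monoˡ-≤ P (∣p∪q∣≤∣p∣+∣q∣ ((F' ─ O') ∩ soon qs τ) (Q ─ O)) ⟩
  ∣ (F' ─ O') ∩ soon qs τ ∣ + ∣ Q ─ O ∣ + P   ≡⟨ +-assoc _ ∣ Q ─ O ∣ P ⟩
  ∣ (F' ─ O') ∩ soon qs τ ∣ + (∣ Q ─ O ∣ + P) ∎
  where open ≤-Reasoning

budget-step : Q ⊆ F' → Q ⊆ O' → F' ⊆ F ∪ Q → O' ⊆ O ∪ Q → FFRule F Q F' qs →
  ∣ F' ∣ ≡ ∣ O' ∣ → Budget F O (Q ∷ qs) P → Budget F' O' qs (∣ Q ─ O ∣ + P)
budget-step {Q = Q} {F' = F'} {O' = O'} {F = F} {O = O} {qs = qs} {P = P}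
  Q⊆F' Q⊆O' F'⊆F∪Q O'⊆O∪Q rule ∣F'∣≡∣O'∣ budget .bound τ
  with nonempty? ((F ─ F') ∩ soon qs τ)
... | yes soon-eviction =
  ≤-trans (soon-eviction⇒balanced Q⊆O' F'⊆F∪Q rule ∣F'∣≡∣O'∣ soon-eviction) (m≤m+n _ _)
... | no late = begin
  ∣ (O' ─ F') ∩ soon qs τ ∣                    ≤⟨ p⊆q⇒∣p∣≤∣q∣ (missing-soon-step Q⊆F' O'⊆O∪Q late) ⟩
  ∣ (O ─ F) ∩ soon (Q ∷ qs) (suc τ) ─ Q ∣      ≤⟨ ∣p─q∣≤∣p∣ ((O ─ F) ∩ soon (Q ∷ qs) (suc τ)) Q ⟩
  ∣ (O ─ F) ∩ soon (Q ∷ qs) (suc τ) ∣          ≤⟨ budget-shift O'⊆O∪Q late budget ⟩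
  ∣ (F' ─ O') ∩ soon qs τ ∣ + (∣ Q ─ O ∣ + P)  ∎
  where open ≤-Reasoning

FFRule-no-eviction : FFRule F Q F qs
FFRule-no-eviction _ _ p∈F p∉F _ _ _ = contradiction p∈F p∉F

budget-step-FF-hit : Q ⊆ F → Q ⊆ O' → O' ⊆ O ∪ Q → ∣ F ∣ ≡ ∣ O' ∣ →
  Budget F O (Q ∷ qs) P → Budget F O' qs (∣ Q ─ O ∣ + P)
budget-step-FF-hit {Q = Q} {F = F} {qs = qs} Q⊆F Q⊆O' O'⊆O∪Q =
  budget-step Q⊆F Q⊆O' (p⊆p∪q Q) O'⊆O∪Q (FFRule-no-eviction {F = F} {Q = Q} {qs = qs})

budget-step-FF-miss : x ∈ Q → x ∉ F → Q ⊆ F' → Q ⊆ O → F' ⊆ F ∪ Q → FFRule F Q F' qs →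
  ∣ F' ∣ ≡ ∣ O ∣ → Budget F O (Q ∷ qs) (suc P) → Budget F' O qs P
budget-step-FF-miss {x = x} {Q = Q} {F = F} {F' = F'} {O = O} {qs = qs} {P = P}
  x∈Q x∉F Q⊆F' Q⊆O F'⊆F∪Q rule ∣F'∣≡∣O∣ budget .bound τ
  with nonempty? ((F ─ F') ∩ soon qs τ)
... | yes soon-eviction =
  ≤-trans (soon-eviction⇒balanced Q⊆O F'⊆F∪Q rule ∣F'∣≡∣O∣ soon-eviction) (m≤m+n _ _)
... | no late = ≤-pred (begin-strict
  ∣ (O ─ F') ∩ soon qs τ ∣                       ≤⟨ p⊆q⇒∣p∣≤∣q∣ (missing-soon-step {O = O} Q⊆F' (p⊆p∪q Q) late) ⟩
  ∣ (O ─ F) ∩ soon (Q ∷ qs) (suc τ) ─ Q ∣        <⟨ p∩q≢∅⇒∣p─q∣<∣p∣ ((O ─ F) ∩ soon (Q ∷ qs) (suc τ)) Q (x , x∈missing∩Q) ⟩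
  ∣ (O ─ F) ∩ soon (Q ∷ qs) (suc τ) ∣            ≤⟨ budget-shift (p⊆p∪q Q) late budget ⟩
  ∣ (F' ─ O) ∩ soon qs τ ∣ + (∣ Q ─ O ∣ + suc P) ≡⟨ cong (λ m → ∣ (F' ─ O) ∩ soon qs τ ∣ + (m + suc P)) (p⊆q⇒∣p─q∣≡0 Q⊆O) ⟩
  ∣ (F' ─ O) ∩ soon qs τ ∣ + suc P               ≡⟨ +-suc ∣ (F' ─ O) ∩ soon qs τ ∣ P ⟩
  suc (∣ (F' ─ O) ∩ soon qs τ ∣ + P)             ∎)
  where
  open ≤-Reasoning
  x∈missing∩Q : x ∈ ((O ─ F) ∩ soon (Q ∷ qs) (suc τ)) ∩ Q
  x∈missing∩Q = x∈p∩q⁺ (requested-missing-soon Q⊆O x∈Q x∉F , x∈Q)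

budget-positive : Q ⊆ O → x ∈ Q → x ∉ F → Budget F O (Q ∷ qs) P → 0 < P
budget-positive {Q = Q} {O = O} {F = F} {qs = qs} {P = P} Q⊆O x∈Q x∉F budget = begin-strict
  0                                  <⟨ x∈p⇒0<∣p∣ (requested-missing-soon Q⊆O x∈Q x∉F) ⟩
  ∣ (O ─ F) ∩ soon (Q ∷ qs) 0 ∣      ≤⟨ budget .bound 0 ⟩
  ∣ (F ─ O) ∩ soon (Q ∷ qs) 0 ∣ + P  ≤⟨ +-monoˡ-≤ P (p⊆q⇒∣p∣≤∣q∣ surplus-now⊆Q─O) ⟩
  ∣ Q ─ O ∣ + P                      ≡⟨ cong (_+ P) (p⊆q⇒∣p─q∣≡0 Q⊆O) ⟩
  P                                  ∎
  where
  open ≤-Reasoning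
  surplus-now⊆Q─O : (F ─ O) ∩ soon (Q ∷ qs) 0 ⊆ Q ─ O
  surplus-now⊆Q─O x∈ with x∈p∩q⁻ (F ─ O) _ x∈
  ... | x∈F─O , x-now with x∈p─q⁻ F O x∈F─O
  ... | _ , x∉O = x∈p∧x∉q⇒x∈p─q (soon-∷-zero⊆ x-now) x∉O

miss-cost : ∀ l opt P → l + (2 * l * opt + (l + P)) ≡ 2 * l * suc opt + P
miss-cost = solve-∀

OPT-miss-cost : ff ≤ 2 * l * opt + (l + P) → ff ≤ 2 * l * suc opt + P
OPT-miss-cost {l = l} {opt = opt} {P = P} ff≤ =
  ≤-trans ff≤ (≤-trans (m≤n+m _ l) (≤-reflexive (miss-cost l opt P)))

FF-miss-cost : ff ≤ 2 * l * opt + P → suc ff ≤ 2 * l * opt + suc P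
FF-miss-cost {l = l} {opt = opt} {P = P} ff≤ =
  ≤-trans (s≤s ff≤) (≤-reflexive (sym (+-suc (2 * l * opt) P)))

both-miss-cost : 0 < l → ff ≤ 2 * l * opt + (l + P) → suc ff ≤ 2 * l * suc opt + P
both-miss-cost {l = l} {opt = opt} {P = P} 0<l ff≤ =
  ≤-trans (s≤s ff≤) (≤-trans (+-monoˡ-≤ _ 0<l) (≤-reflexive (miss-cost l opt P)))

open MissStep

ff≤2l*opt+budget : ∣ F ∣ ≡ k → ∣ O ∣ ≡ k → All (λ Q → ∣ Q ∣ ≡ l) σ →
  FFRun k F σ ff → Run k O σ opt → Budget F O σ P → ff ≤ 2 * l * opt + P
ff≤2l*opt+budget _ _ [] done done _ = z≤n
ff≤2l*opt+budget ∣F∣ ∣O∣ (_ ∷ ∣Q∣s) (hit Q⊆F ff-run) (hit Q⊆O opt-run) budget =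
  ff≤2l*opt+budget ∣F∣ ∣O∣ ∣Q∣s ff-run opt-run
    (subst (λ m → Budget _ _ _ (m + _)) (p⊆q⇒∣p─q∣≡0 Q⊆O)
      (budget-step-FF-hit Q⊆F Q⊆O (p⊆p∪q _) (trans ∣F∣ (sym ∣O∣)) budget))
ff≤2l*opt+budget {l = l} ∣F∣ ∣O∣ (∣Q∣ ∷ ∣Q∣s) (hit {Q = Q} Q⊆F ff-run) (miss _ O-step opt-run) budget =
  OPT-miss-cost {l = l} (ff≤2l*opt+budget ∣F∣ (size O-step) ∣Q∣s ff-run opt-run
    (Budget-mono-request {Q = Q} ∣Q∣ (budget-step-FF-hit Q⊆F (covers O-step) (onlyQ O-step)
      (trans ∣F∣ (sym (size O-step))) budget)))
ff≤2l*opt+budget {l = l} ∣F∣ ∣O∣ (_ ∷ ∣Q∣s) (miss Q⊈F F-step rule ff-run) (hit Q⊆O opt-run) budget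
  with p⊈q⇒∃x∈p∧x∉q Q⊈F
... | x , x∈Q , x∉F with budget-positive Q⊆O x∈Q x∉F budget
... | s≤s _ = FF-miss-cost {l = l} (ff≤2l*opt+budget (size F-step) ∣O∣ ∣Q∣s ff-run opt-run
  (budget-step-FF-miss x∈Q x∉F (covers F-step) Q⊆O (onlyQ F-step) rule
    (trans (size F-step) (sym ∣O∣)) budget))
ff≤2l*opt+budget ∣F∣ ∣O∣ (∣Q∣ ∷ ∣Q∣s) (miss {Q = Q} Q⊈F F-step rule ff-run) (miss _ O-step opt-run) budget
  with p⊈q⇒∃x∈p∧x∉q Q⊈F
... | x , x∈Q , _ = both-miss-cost (subst (0 <_) ∣Q∣ (x∈p⇒0<∣p∣ x∈Q))
  (ff≤2l*opt+budget (size F-step) (size O-step) ∣Q∣s ff-run opt-run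
    (Budget-mono-request {Q = Q} ∣Q∣ (budget-step (covers F-step) (covers O-step) (onlyQ F-step)
      (onlyQ O-step) rule (trans (size F-step) (sym (size O-step))) budget)))

theorem8p3 : (N k l : ℕ) → l ≤ k → (C₀ : Subset N) → ∣ C₀ ∣ ≡ k →
    ∃ λ (c : ℕ) → ∀ (σ : List (Subset N)) → All (λ Q → ∣ Q ∣ ≡ l) σ →
      ∀ (opt ff : ℕ) → IsOPT k C₀ σ opt → FFRun k C₀ σ ff →
      ff ≤ 2 * l * opt + c
-- Both runs start from C₀, so the budget starts at 0.
theorem8p3 N k l _ C₀ ∣C₀∣ = 0 , λ σ ∣Q∣s opt ff (opt-run , _) ff-run →
  ff≤2l*opt+budget ∣C₀∣ ∣C₀∣ ∣Q∣s ff-run opt-run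
    record { bound = λ τ → m≤m+n _ 0 }
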